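{- Let $f:2^{\mathcal{N}}\to\mathbb{Z}_{\ge0}$ be a polymatroid with $f(\{e\})>0$ for every $e\in\mathcal{N}$, $r=f(\mathcal{N})\ge2$ and $k^*:=k^*(f)\ge120\log^2 r$. Let $e_1,\dots,e_n$ be an ordering of $\mathcal{N}$. Let $A\subseteq\mathcal{N}$ be a closed set of $f$, and let $T\ge1$ be the smallest integer such that $$\sum_{e\in\mathcal{N}_T\setminus A}\big(f(A\cup\{e\})-f(A)\big)\ge k^*\cdot\big(f(\mathcal{N})-f(A)\big).$$ Then for every $t\in[T]$ with $e_t\in\mathcal{N}_T\setminus A$, we have $q_t<2rk^*$.
   Context: A polymatroid is an integer-valued, monotone, submodular set function with value $0$ on the empty set. For a polymatroid $g$ on ground set $\mathcal{M}$, $k^*(g):=\min_{A\subseteq\mathcal{M}:\, g(A)<g(\mathcal{M})}\left\lfloor\frac{\sum_{e\in\mathcal{M}}(g(A\cup\{e\})-g(A))}{g(\mathcal{M})-g(A)}\right\rfloor$. $\mathrm{span}(S)=\{e\in\mathcal{N}: f(S\cup\{e\})=f(S)\}$; $S$ is closed if $\mathrm{span}(S)=S$. A set $Q\subseteq\mathcal{V}$ is a quotient of a polymatroid $h$ on $\mathcal{V}$ if $h((\mathcal{V}\setminus Q)\cup\{e\})>h(\mathcal{V}\setminus Q)$ for every $e\in Q$. $\mathcal{N}_t=\{e_1,\dots,e_t\}$, $f_{|\mathcal{N}_t}$ is the restriction of $f$ to $\mathcal{N}_t$, and $q_t=\min\{|Q|: e_t\in Q\subseteq\mathcal{N}_t,\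 Q\text{ a quotient of }f_{|\mathcal{N}_t}\}$. Logarithms are base 2. -}

module Defs where

open import Data.Nat using (ℕ; zero; suc; _+_; _*_; _∸_; _^_; _≤_; _<_; _/_; _<ᵇ_)
open import Data.Bool using (Bool; true; false; if_then_else_)
open import Data.Fin using (Fin; toℕ)
open import Data.Fin.Subset using (Subset; _∈_; _∉_; _⊆_; _∪_; _∩_; _─_; ⁅_⁆; ⊤; ⊥; ∣_∣)
open import Data.Vec using (Vec; tabulate; lookup; sum)
open import Data.Product using (Σ; _×_; ∃)
open import Relation.Binary.PropositionalEquality using (_≡_)
open import Function.Bundles using (_⇔_)

-- Ground set 𝓝 = Fin n, with the ordering e₁,…,eₙ given by e_{t} = the element of index t-1.
SetFn : ℕ → Set
SetFn n = Subset n → ℕ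

record IsPolymatroid {n : ℕ} (f : SetFn n) : Set where
  field
    empty0     : f ⊥ ≡ 0
    monotone   : ∀ A B → A ⊆ B → f A ≤ f B
    submodular : ∀ A B → f (A ∪ B) + f (A ∩ B) ≤ f A + f B

sumFin : {n : ℕ} → (Fin n → ℕ) → ℕ
sumFin g = sum (tabulate g)

sumOver : {n : ℕ} → Subset n → (Fin n → ℕ) → ℕ
sumOver S g = sumFin (λ e → if lookup S e then g e else 0)

marg : {n : ℕ} → SetFn n → Subset n → Fin n → ℕ
marg f A e = f (A ∪ ⁅ e ⁆) ∸ f A

-- floor division (the denominator is always positive where it is used)
divFloor : ℕ → ℕ → ℕ
divFloor a zero    = 0
divFloor a (suc b) = a / suc b

kRatio : {n : ℕ} → SetFn n → Subset n → ℕ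
kRatio f A = divFloor (sumFin (marg f A)) (f ⊤ ∸ f A)

IsKStar : {n : ℕ} → SetFn n → ℕ → Set
IsKStar f k =
  (Σ _ λ A → f A < f ⊤ × kRatio f A ≡ k) ×
  (∀ A → f A < f ⊤ → k ≤ kRatio f A)

InSpan : {n : ℕ} → SetFn n → Subset n → Fin n → Set
InSpan f S e = f (S ∪ ⁅ e ⁆) ≡ f S

IsClosed : {n : ℕ} → SetFn n → Subset n → Set
IsClosed f S = ∀ e → (InSpan f S e ⇔ e ∈ S)

-- 𝓝_t = {e₁,…,e_t} = elements with index < t
prefix : {n : ℕ} → ℕ → Subset n
prefix t = tabulate (λ j → toℕ j <ᵇ t)

-- Q is a quotient of the polymatroid h on ground set V (h = f restricted to V, V ⊆ 𝓝):
-- Q ⊆ V and h((V∖Q) ∪ {e}) > h(V∖Q) for all e ∈ Q.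
IsQuotientOn : {n : ℕ} → SetFn n → Subset n → Subset n → Set
IsQuotientOn f V Q = Q ⊆ V × (∀ e → e ∈ Q → f (V ─ Q) < f ((V ─ Q) ∪ ⁅ e ⁆))

-- For the element e_t (index i, so t = toℕ i + 1), q is q_t:
-- the minimum of |Q| over quotients Q of f|𝓝_t with e_t ∈ Q ⊆ 𝓝_t.
IsQt : {n : ℕ} → SetFn n → Fin n → ℕ → Set
IsQt f i q =
  (Σ _ λ Q → IsQuotientOn f (prefix (suc (toℕ i))) Q × i ∈ Q × ∣ Q ∣ ≡ q) ×
  (∀ Q → IsQuotientOn f (prefix (suc (toℕ i))) Q → i ∈ Q → q ≤ ∣ Q ∣)

-- The real-number condition  120 · (log₂ r)² ≤ k, stated exactly over ℕ:
-- for all naturals p, q with q > 0 and 2^p < r^q (i.e. p/q < log₂ r), 120 p² ≤ k q².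
-- (Equivalent to the real inequality by density of ℚ.)
LogSqBound : ℕ → ℕ → Set
LogSqBound r k = ∀ p q → 0 < q → 2 ^ p < r ^ q → 120 * (p * p) ≤ k * (q * q)

TCond : {n : ℕ} → SetFn n → ℕ → Subset n → ℕ → Set
TCond f k A T = k * (f ⊤ ∸ f A) ≤ sumOver (prefix T ─ A) (marg f A)

IsSmallestT : {n : ℕ} → SetFn n → ℕ → Subset n → ℕ → Set
IsSmallestT f k A T = 1 ≤ T × TCond f k A T × (∀ T′ → 1 ≤ T′ → TCond f k A T′ → T ≤ T′)

-- For e_t ∉ A the set Q = 𝓝_t ∖ A is itself a quotient of f|𝓝_t containing e_t: since A is
-- closed every e ∉ A has positive gain over A, and submodularity carries that gain down to
-- every subset of A, in particular to 𝓝_t ∖ Q ⊆ A.  Each e ∉ A has marginal value ≥ 1 over A,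
-- so |𝓝_{t-1} ∖ A| is at most the marginal sum over 𝓝_{t-1} ∖ A, which by minimality of T is
-- below k*(r − f(A)) (for t = 1 the set is empty).  Hence q_t ≤ |Q| ≤ k*r < 2rk*; of the
-- bound on k* only k* ≥ 1 is needed.
module Submission where

open import Defs
open import Data.Nat using (ℕ; suc; _+_; _*_; _≤_; _<_)
open import Data.Fin using (Fin; toℕ)
open import Data.Fin.Subset using (Subset; _∈_; _∉_; _─_; ⁅_⁆; ⊤; ⊥)

open import Data.Nat using (zero; _∸_; _<ᵇ_; z≤n; s≤s; s≤s⁻¹; _≤?_)
open import Data.Nat.Properties
open import Data.Bool.Properties using (T-≡)
open import Data.Fin.Properties using (toℕ-injective)
open import Data.Fin as Fin using ()
open import Data.Fin.Subset using (_∪_; _∩_; _⊆_; ∣_∣; inside; outside)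
open import Data.Fin.Subset.Properties
  using (_∈?_; p⊆p∪q; x∈p∪q⁻; x∈p∪q⁺; x∈p∩q⁺; x∈⁅x⁆; ∣⁅x⁆∣≡1; ∣⊥∣≡0; ∣p∣≤∣x∷p∣;
         p⊆q⇒∣p∣≤∣q∣; p─q⊆p; ∣p─q∣≤∣p∣; x∈p∧x∉q⇒x∈p─q)
open import Data.Vec using ([]; _∷_; here; there)
open import Data.Vec.Properties using (lookup∘tabulate; []=⇒lookup; lookup⇒[]=)
open import Data.Product using (_,_)
open import Data.Sum using (inj₁; inj₂; [_,_])
open import Function using (_∘_)
open import Function.Bundles using (Equivalence)
open import Relation.Nullary using (yes; no; contradiction)
open import Relation.Binary.PropositionalEquality hiding ([_])

x∈p─q⇒x∉q : ∀ {n} {x : Fin n} (p q : Subset n) → x ∈ p ─ q → x ∉ q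
x∈p─q⇒x∉q (inside ∷ p) (outside ∷ q) here ()
x∈p─q⇒x∉q (_ ∷ p) (_ ∷ q) (there x∈p─q) (there x∈q) = x∈p─q⇒x∉q p q x∈p─q x∈q

p─[p─q]⊆q : ∀ {n} (p q : Subset n) → p ─ (p ─ q) ⊆ q
p─[p─q]⊆q p q {x} x∈ with x ∈? q
... | yes x∈q = x∈q
... | no x∉q  = contradiction (x∈p∧x∉q⇒x∈p─q (p─q⊆p p (p ─ q) x∈) x∉q) (x∈p─q⇒x∉q p (p ─ q) x∈)

∣p∪q∣≤∣p∣+∣q∣ : ∀ {n} (p q : Subset n) → ∣ p ∪ q ∣ ≤ ∣ p ∣ + ∣ q ∣
∣p∪q∣≤∣p∣+∣q∣ [] [] = z≤n
∣p∪q∣≤∣p∣+∣q∣ (inside ∷ p) (t ∷ q) =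
  s≤s (≤-trans (∣p∪q∣≤∣p∣+∣q∣ p q) (+-monoʳ-≤ ∣ p ∣ (∣p∣≤∣x∷p∣ t q)))
∣p∪q∣≤∣p∣+∣q∣ (outside ∷ p) (inside ∷ q) =
  ≤-trans (s≤s (∣p∪q∣≤∣p∣+∣q∣ p q)) (≤-reflexive (sym (+-suc ∣ p ∣ ∣ q ∣)))
∣p∪q∣≤∣p∣+∣q∣ (outside ∷ p) (outside ∷ q) = ∣p∪q∣≤∣p∣+∣q∣ p q

∣p∣≤sumOver : ∀ {n} (p : Subset n) (g : Fin n → ℕ) → (∀ {e} → e ∈ p → 1 ≤ g e) →
              ∣ p ∣ ≤ sumOver p g
∣p∣≤sumOver []           g pos = z≤n
∣p∣≤sumOver (inside ∷ p)  g pos = +-mono-≤ (pos here) (∣p∣≤sumOver p (g ∘ Fin.suc) (pos ∘ there))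
∣p∣≤sumOver (outside ∷ p) g pos = ∣p∣≤sumOver p (g ∘ Fin.suc) (pos ∘ there)

∈prefix⇒< : ∀ {n} t {e : Fin n} → e ∈ prefix t → toℕ e < t
∈prefix⇒< t {e} e∈ = <ᵇ⇒< (toℕ e) t
  (Equivalence.from T-≡ (trans (sym (lookup∘tabulate (λ j → toℕ j <ᵇ t) e)) ([]=⇒lookup e∈)))

<⇒∈prefix : ∀ {n} t {e : Fin n} → toℕ e < t → e ∈ prefix t
<⇒∈prefix t {e} e<t = lookup⇒[]= e (prefix t)
  (trans (lookup∘tabulate (λ j → toℕ j <ᵇ t) e) (Equivalence.to T-≡ (<⇒<ᵇ e<t)))

prefix-zero : ∀ {n} → prefix {n} 0 ≡ ⊥
prefix-zero {zero}  = refl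
prefix-zero {suc n} = cong (outside ∷_) (prefix-zero {n})

prefix-suc─⊆ : ∀ {n} (A : Subset n) (i : Fin n) →
               prefix (suc (toℕ i)) ─ A ⊆ (prefix (toℕ i) ─ A) ∪ ⁅ i ⁆
prefix-suc─⊆ A i {x} x∈ with m≤n⇒m<n∨m≡n (s≤s⁻¹ (∈prefix⇒< _ (p─q⊆p _ A x∈)))
... | inj₁ x<i = x∈p∪q⁺ (inj₁ (x∈p∧x∉q⇒x∈p─q (<⇒∈prefix _ x<i) (x∈p─q⇒x∉q _ A x∈)))
... | inj₂ x≡i = x∈p∪q⁺ (inj₂ (subst (_∈ ⁅ i ⁆) (sym (toℕ-injective x≡i)) (x∈⁅x⁆ i)))

∣prefix-suc─∣≤ : ∀ {n} (A : Subset n) (i : Fin n) →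
                 ∣ prefix (suc (toℕ i)) ─ A ∣ ≤ suc ∣ prefix (toℕ i) ─ A ∣
∣prefix-suc─∣≤ A i = begin
  ∣ prefix (suc (toℕ i)) ─ A ∣  ≤⟨ p⊆q⇒∣p∣≤∣q∣ (prefix-suc─⊆ A i) ⟩
  ∣ P ∪ ⁅ i ⁆ ∣                  ≤⟨ ∣p∪q∣≤∣p∣+∣q∣ P ⁅ i ⁆ ⟩
  ∣ P ∣ + ∣ ⁅ i ⁆ ∣              ≡⟨ cong (∣ P ∣ +_) (∣⁅x⁆∣≡1 i) ⟩
  ∣ P ∣ + 1                      ≡⟨ +-comm ∣ P ∣ 1 ⟩
  suc ∣ P ∣                      ∎
  where
  open ≤-Reasoning
  P = prefix (toℕ i) ─ A

LogSqBound⇒1≤k : ∀ {r k} → 2 ≤ r → LogSqBound r k → 1 ≤ k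
LogSqBound⇒1≤k {k = zero} 2≤r bound =
  contradiction (bound 1 2 (s≤s z≤n) (<-≤-trans (s≤s (s≤s (s≤s z≤n))) (^-monoˡ-≤ 2 2≤r))) λ ()
LogSqBound⇒1≤k {k = suc k} _ _ = s≤s z≤n

module _ {n : ℕ} {f : SetFn n} (poly : IsPolymatroid f) {A : Subset n} (closed : IsClosed f A)
  where
  open IsPolymatroid poly

  closed-gain : ∀ {e} → e ∉ A → f A < f (A ∪ ⁅ e ⁆)
  closed-gain {e} e∉A = ≤∧≢⇒< (monotone A (A ∪ ⁅ e ⁆) (p⊆p∪q ⁅ e ⁆))
                               (e∉A ∘ Equivalence.to (closed e) ∘ sym)

  closed-gain-below : ∀ {X e} → X ⊆ A → e ∉ A → f X < f (X ∪ ⁅ e ⁆)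
  closed-gain-below {X} {e} X⊆A e∉A = +-cancelˡ-< (f A) (f X) (f Y) (begin-strict
    f A + f X              <⟨ +-monoˡ-< (f X) (closed-gain e∉A) ⟩
    f (A ∪ ⁅ e ⁆) + f X    ≤⟨ +-mono-≤ (monotone _ _ A∪e⊆A∪Y) (monotone _ _ X⊆A∩Y) ⟩
    f (A ∪ Y) + f (A ∩ Y)  ≤⟨ submodular A Y ⟩
    f A + f Y              ∎)
    where
    open ≤-Reasoning
    Y = X ∪ ⁅ e ⁆
    A∪e⊆A∪Y : A ∪ ⁅ e ⁆ ⊆ A ∪ Y
    A∪e⊆A∪Y = [ x∈p∪q⁺ ∘ inj₁ , x∈p∪q⁺ ∘ inj₂ ∘ x∈p∪q⁺ ∘ inj₂ ] ∘ x∈p∪q⁻ A ⁅ e ⁆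
    X⊆A∩Y : X ⊆ A ∩ Y
    X⊆A∩Y x∈X = x∈p∩q⁺ (X⊆A x∈X , x∈p∪q⁺ (inj₁ x∈X))

  ─closed-isQuotient : ∀ V → IsQuotientOn f V (V ─ A)
  ─closed-isQuotient V =
    p─q⊆p V A , λ e e∈ → closed-gain-below (p─[p─q]⊆q V A) (x∈p─q⇒x∉q V A e∈)

  ∣prefix─∣≤sum : ∀ t → ∣ prefix t ─ A ∣ ≤ sumOver (prefix t ─ A) (marg f A)
  ∣prefix─∣≤sum t = ∣p∣≤sumOver (prefix t ─ A) (marg f A)
    (m<n⇒0<n∸m ∘ closed-gain ∘ x∈p─q⇒x∉q (prefix t) A)

  ∣prefix─∣<k*r : ∀ {k T} → IsSmallestT f k A T → 0 < k * f ⊤ →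
                  ∀ t → t < T → ∣ prefix t ─ A ∣ < k * f ⊤
  ∣prefix─∣<k*r _ 0<kr zero _ = begin-strict
    ∣ prefix 0 ─ A ∣  ≤⟨ ∣p─q∣≤∣p∣ (prefix 0) A ⟩
    ∣ prefix {n} 0 ∣  ≡⟨ cong ∣_∣ (prefix-zero {n}) ⟩
    ∣ ⊥ {n} ∣         ≡⟨ ∣⊥∣≡0 n ⟩
    0                 <⟨ 0<kr ⟩
    _                 ∎
    where open ≤-Reasoning
  ∣prefix─∣<k*r {k} {T} (_ , _ , minimal) _ t@(suc _) t<T = begin-strict
    ∣ prefix t ─ A ∣                   ≤⟨ ∣prefix─∣≤sum t ⟩
    sumOver (prefix t ─ A) (marg f A)  <⟨ sum<k*gap ⟩
    k * (f ⊤ ∸ f A)                    ≤⟨ *-monoʳ-≤ k (m∸n≤m (f ⊤) (f A)) ⟩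
    k * f ⊤                            ∎
    where
    open ≤-Reasoning
    sum<k*gap : sumOver (prefix t ─ A) (marg f A) < k * (f ⊤ ∸ f A)
    sum<k*gap with k * (f ⊤ ∸ f A) ≤? sumOver (prefix t ─ A) (marg f A)
    ... | yes cond = contradiction (minimal t (s≤s z≤n) cond) (<⇒≱ t<T)
    ... | no ¬cond = ≰⇒> ¬cond

lemma3p3 : (n : ℕ) (f : SetFn n) → IsPolymatroid f →
    (∀ e → 0 < f ⁅ e ⁆) →
    2 ≤ f ⊤ →
    (k : ℕ) → IsKStar f k → LogSqBound (f ⊤) k →
    (A : Subset n) → IsClosed f A →
    (T : ℕ) → IsSmallestT f k A T →
    (i : Fin n) → suc (toℕ i) ≤ T → i ∈ prefix T ─ A →
    (q : ℕ) → IsQt f i q →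
    q < 2 * f ⊤ * k
lemma3p3 n f poly _ 2≤r k _ logBound A closed T smallestT i i<T i∈ q (_ , minimal) = begin-strict
  q                               ≤⟨ minimal Q (─closed-isQuotient poly closed V) i∈Q ⟩
  ∣ Q ∣                           ≤⟨ ∣prefix-suc─∣≤ A i ⟩
  suc ∣ prefix (toℕ i) ─ A ∣      ≤⟨ ∣prefix─∣<k*r poly closed {k} {T} smallestT 0<kr (toℕ i) i<T ⟩
  k * r                           <⟨ m<m+n (k * r) 0<kr ⟩
  k * r + k * r                   ≡⟨ cong (k * r +_) (+-identityʳ (k * r)) ⟨
  2 * (k * r)                     ≡⟨ cong (2 *_) (*-comm k r) ⟩
  2 * (r * k)                     ≡⟨ *-assoc 2 r k ⟨
  2 * r * k                       ∎
  where
  open ≤-Reasoning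
  r = f ⊤
  V = prefix (suc (toℕ i))
  Q = V ─ A
  i∈Q : i ∈ Q
  i∈Q = x∈p∧x∉q⇒x∈p─q (<⇒∈prefix _ ≤-refl) (x∈p─q⇒x∉q (prefix T) A i∈)
  0<kr : 0 < k * r
  0<kr = *-mono-≤ (LogSqBound⇒1≤k {k = k} 2≤r logBound) (≤-trans (s≤s z≤n) 2≤r)
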